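{- Let $\Gamma=\langle\alpha_1,\ldots,\alpha_k\rangle\subset\mathbb N^d$ be an affine semigroup, let $A$ be the $d\times k$ matrix with columns $\alpha_1,\ldots,\alpha_k$, fix $i\le k$, and fix $z\in\mathrm{Minimals}_\le\mathsf Z(\alpha_i+\Gamma)$. If $z_i=0$ and $w\in\mathbb N^k$ satisfies $w_i\ne0$ and $Aw=Az$, then $z\cdot w=0$ and $\mathrm{dist}(z,w)=\max\{|z|,|w|\}$.
   Context: An affine semigroup is a finitely generated submonoid of $\mathbb N^d$ with minimal generating set $\alpha_1,\ldots,\alpha_k$; $\varphi_\Gamma(z)=Az$, $\mathsf Z(\gamma)=\varphi_\Gamma^{ -1}(\gamma)$, and $\mathsf Z(\alpha_i+\Gamma)=\{x\in\mathbb N^k:\varphi_\Gamma(x)\in\alpha_i+\Gamma\}$; $\mathrm{Minimals}_\le$ denotes minimal elements in the componentwise order on $\mathbb N^k$. $|z|=z_1+\cdots+z_k$, $z\cdot w$ is the usual dot product, $\gcd(z,w)=(\min(z_l,w_l))_l$, and $\mathrm{dist}(z,w)=\max(|z-\gcd(z,w)|,|w-\gcd(z,w)|)$. -}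

module Defs where

open import Data.Nat using (ℕ; zero; suc; _+_; _*_; _∸_; _≤_; _⊔_; _⊓_)
open import Data.Fin using (Fin)
open import Data.Product using (Σ; ∃; _×_)
open import Relation.Binary.PropositionalEquality using (_≡_)
open import Relation.Nullary using (¬_)

Vecℕ : ℕ → Set
Vecℕ n = Fin n → ℕ

Σ[<_]_ : (n : ℕ) → (Fin n → ℕ) → ℕ
Σ[< zero ] f = 0
Σ[< suc n ] f = f Fin.zero + Σ[< n ] (λ j → f (Fin.suc j))

_⊕_ : ∀ {n} → Vecℕ n → Vecℕ n → Vecℕ n
(u ⊕ v) l = u l + v l

_≤ᵥ_ : ∀ {n} → Vecℕ n → Vecℕ n → Set
u ≤ᵥ v = ∀ l → u l ≤ v l

-- generators α : Fin k → ℕ^d ; factorization map φ(x) = A x = Σ x_j α_j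
φ : ∀ {d k} → (Fin k → Vecℕ d) → Vecℕ k → Vecℕ d
φ {k = k} α x l = Σ[< k ] (λ j → x j * α j l)

_∈Γ_ : ∀ {d k} → Vecℕ d → (Fin k → Vecℕ d) → Set
γ ∈Γ α = ∃ λ x → (∀ l → φ α x l ≡ γ l)

MinimalGenerators : ∀ {d k} → (Fin k → Vecℕ d) → Set
MinimalGenerators {k = k} α =
  ∀ i → ¬ (∃ λ (x : Vecℕ k) → x i ≡ 0 × (∀ l → φ α x l ≡ α i l))

-- Z(α_i + Γ) = { x ∈ ℕ^k : φ(x) ∈ α_i + Γ }
InZshift : ∀ {d k} → (Fin k → Vecℕ d) → Fin k → Vecℕ k → Set
InZshift α i x = ∃ λ y → (∀ l → φ α x l ≡ α i l + φ α y l)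

Minimal : ∀ {n} → (Vecℕ n → Set) → Vecℕ n → Set
Minimal S z = S z × (∀ x → S x → x ≤ᵥ z → ∀ l → x l ≡ z l)

∣_∣ᵥ : ∀ {n} → Vecℕ n → ℕ
∣_∣ᵥ {n} z = Σ[< n ] z

_·_ : ∀ {n} → Vecℕ n → Vecℕ n → ℕ
_·_ {n} z w = Σ[< n ] (λ l → z l * w l)

gcdᵥ : ∀ {n} → Vecℕ n → Vecℕ n → Vecℕ n
gcdᵥ z w l = z l ⊓ w l

_-ᵥ_ : ∀ {n} → Vecℕ n → Vecℕ n → Vecℕ n
(z -ᵥ w) l = z l ∸ w l

dist : ∀ {n} → Vecℕ n → Vecℕ n → ℕ
dist z w = ∣ z -ᵥ gcdᵥ z w ∣ᵥ ⊔ ∣ w -ᵥ gcdᵥ z w ∣ᵥ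

module Submission where

-- Let z be a ≤-minimal factorization in
-- Z(α_i + Γ) with z_i = 0, and let w be a factorization of the same element
-- with w_i ≠ 0.  The supports of z and w are disjoint: if z_l ≠ 0 ≠ w_l then
-- l ≠ i, and removing one copy of α_i and one of α_l from w leaves a
-- factorization y with  A(z - e_l) + α_l = Aw = α_i + Ay + α_l,  so z - e_l lies
-- in Z(α_i + Γ) and is strictly below z, contradicting minimality.  For
-- vectors with disjoint supports the dot product vanishes and gcd(z,w) = 0,
-- whence dist(z,w) = max(|z|,|w|).

open import Defs
open import Data.Nat using (ℕ; zero; suc; _+_; _*_; _∸_; _⊔_)
open import Data.Nat.Properties
  using (+-comm; +-assoc; +-cancelʳ-≡; *-zeroʳ; ⊓-zeroʳ; m∸n≤m; ≤-refl)
open import Data.Fin using (Fin) renaming (_≟_ to _≟ᶠ_)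
open import Data.Fin.Properties using (suc-injective)
open import Data.Product using (_×_; _,_)
open import Data.Sum using (_⊎_; inj₁; inj₂)
open import Data.Empty using (⊥; ⊥-elim)
open import Relation.Nullary using (yes; no)
open import Relation.Binary.PropositionalEquality
  using (_≡_; _≢_; refl; sym; trans; cong; cong₂; module ≡-Reasoning)

open ≡-Reasoning

Σ-cong : ∀ n {f g : Fin n → ℕ} → (∀ j → f j ≡ g j) → Σ[< n ] f ≡ Σ[< n ] g
Σ-cong zero    e = refl
Σ-cong (suc n) e = cong₂ _+_ (e Fin.zero) (Σ-cong n (λ j → e (Fin.suc j)))

Σ-zero : ∀ n {f : Fin n → ℕ} → (∀ j → f j ≡ 0) → Σ[< n ] f ≡ 0
Σ-zero zero    e = refl
Σ-zero (suc n) e = cong₂ _+_ (e Fin.zero) (Σ-zero n (λ j → e (Fin.suc j)))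

Σ-point : ∀ n {f g : Fin n → ℕ} (l : Fin n) (c : ℕ) → g l + c ≡ f l →
  (∀ j → j ≢ l → g j ≡ f j) → Σ[< n ] g + c ≡ Σ[< n ] f
Σ-point (suc n) {f} {g} Fin.zero c eₗ others = begin
  (g Fin.zero + Σg) + c   ≡⟨ +-assoc (g Fin.zero) Σg c ⟩
  g Fin.zero + (Σg + c)   ≡⟨ cong (g Fin.zero +_) (+-comm Σg c) ⟩
  g Fin.zero + (c + Σg)   ≡⟨ sym (+-assoc (g Fin.zero) c Σg) ⟩
  (g Fin.zero + c) + Σg   ≡⟨ cong₂ _+_ eₗ (Σ-cong n (λ j → others (Fin.suc j) (λ ()))) ⟩
  f Fin.zero + Σ[< n ] (λ j → f (Fin.suc j)) ∎
  where Σg = Σ[< n ] (λ j → g (Fin.suc j))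
Σ-point (suc n) {f} {g} (Fin.suc l) c eₗ others =
  trans (+-assoc (g Fin.zero) _ c)
        (cong₂ _+_ (others Fin.zero (λ ()))
                   (Σ-point n l c eₗ (λ j j≢l → others (Fin.suc j) (λ e → j≢l (suc-injective e)))))

pred-*-+ : ∀ n a → n ≢ 0 → (n ∸ 1) * a + a ≡ n * a
pred-*-+ zero    a n≢0 = ⊥-elim (n≢0 refl)
pred-*-+ (suc n) a _   = +-comm (n * a) a

_-e_ : ∀ {k} → Vecℕ k → Fin k → Vecℕ k
(v -e l) j with j ≟ᶠ l
... | yes _ = v j ∸ 1
... | no  _ = v j

-e-at : ∀ {k} (v : Vecℕ k) l → (v -e l) l ≡ v l ∸ 1
-e-at v l with l ≟ᶠ l
... | yes _   = refl
... | no  l≢l = ⊥-elim (l≢l refl)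

-e-away : ∀ {k} (v : Vecℕ k) l j → j ≢ l → (v -e l) j ≡ v j
-e-away v l j j≢l with j ≟ᶠ l
... | yes j≡l = ⊥-elim (j≢l j≡l)
... | no  _   = refl

-e-≤ᵥ : ∀ {k} (v : Vecℕ k) l → (v -e l) ≤ᵥ v
-e-≤ᵥ v l j with j ≟ᶠ l
... | yes _ = m∸n≤m (v j) 1
... | no  _ = ≤-refl

-e-drops : ∀ {k} (v : Vecℕ k) l → v l ≢ 0 → (v -e l) l ≢ v l
-e-drops v l vₗ≢0 e with v l | -e-at v l
... | zero  | _     = vₗ≢0 refl
... | suc n | eq-at = n≢1+n (trans (sym eq-at) e)
  where
  n≢1+n : ∀ {n} → n ≢ suc n
  n≢1+n ()

φ-e : ∀ {d k} (α : Fin k → Vecℕ d) (v : Vecℕ k) l → v l ≢ 0 →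
  ∀ m → φ α (v -e l) m + α l m ≡ φ α v m
φ-e {k = k} α v l vₗ≢0 m =
  Σ-point k l (α l m)
    (trans (cong (λ t → t * α l m + α l m) (-e-at v l)) (pred-*-+ (v l) (α l m) vₗ≢0))
    (λ j j≢l → cong (_* α j m) (-e-away v l j j≢l))

shift-member : ∀ {d k} (α : Fin k → Vecℕ d) {i l : Fin k} (x w : Vecℕ k) →
  l ≢ i → w i ≢ 0 → w l ≢ 0 → (∀ m → φ α x m + α l m ≡ φ α w m) →
  InZshift α i x
shift-member α {i} {l} x w l≢i wᵢ≢0 wₗ≢0 ex = y , λ m → +-cancelʳ-≡ (α l m) _ _ (split m)
  where
  w′ = w -e i
  y  = w′ -e l
  w′ₗ≢0 : w′ l ≢ 0
  w′ₗ≢0 = λ e → wₗ≢0 (trans (sym (-e-away w i l l≢i)) e)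
  split : ∀ m → φ α x m + α l m ≡ (α i m + φ α y m) + α l m
  split m = begin
    φ α x m + α l m                  ≡⟨ ex m ⟩
    φ α w m                          ≡⟨ sym (φ-e α w i wᵢ≢0 m) ⟩
    φ α w′ m + α i m                 ≡⟨ cong (_+ α i m) (sym (φ-e α w′ l w′ₗ≢0 m)) ⟩
    (φ α y m + α l m) + α i m        ≡⟨ +-assoc (φ α y m) (α l m) (α i m) ⟩
    φ α y m + (α l m + α i m)        ≡⟨ cong (φ α y m +_) (+-comm (α l m) (α i m)) ⟩
    φ α y m + (α i m + α l m)        ≡⟨ sym (+-assoc (φ α y m) (α i m) (α l m)) ⟩
    (φ α y m + α i m) + α l m        ≡⟨ cong (_+ α l m) (+-comm (φ α y m) (α i m)) ⟩
    (α i m + φ α y m) + α l m        ∎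

minimal-disjoint : ∀ {d k} (α : Fin k → Vecℕ d) {i : Fin k} {z : Vecℕ k} →
  Minimal (InZshift α i) z → (w : Vecℕ k) → w i ≢ 0 →
  (∀ m → φ α w m ≡ φ α z m) →
  ∀ l → l ≢ i → z l ≢ 0 → w l ≢ 0 → ⊥
minimal-disjoint α {i} {z} (_ , minimal) w wᵢ≢0 same l l≢i zₗ≢0 wₗ≢0 =
  -e-drops z l zₗ≢0 (minimal (z -e l) below (-e-≤ᵥ z l) l)
  where
  below : InZshift α i (z -e l)
  below = shift-member α (z -e l) w l≢i wᵢ≢0 wₗ≢0
            (λ m → trans (φ-e α z l zₗ≢0 m) (sym (same m)))

DisjointSupports : ∀ {n} → Vecℕ n → Vecℕ n → Set
DisjointSupports z w = ∀ l → z l ≡ 0 ⊎ w l ≡ 0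

disjoint-supports : ∀ {n} (z w : Vecℕ n) →
  (∀ l → z l ≢ 0 → w l ≢ 0 → ⊥) → DisjointSupports z w
disjoint-supports z w never l with z l | w l | never l
... | zero  | _     | _ = inj₁ refl
... | suc _ | zero  | _ = inj₂ refl
... | suc _ | suc _ | n = ⊥-elim (n (λ ()) (λ ()))

disjoint-dot : ∀ {n} (z w : Vecℕ n) → DisjointSupports z w → z · w ≡ 0
disjoint-dot {n} z w disj = Σ-zero n product-zero
  where
  product-zero : ∀ l → z l * w l ≡ 0
  product-zero l with disj l
  ... | inj₁ zₗ≡0 rewrite zₗ≡0 = refl
  ... | inj₂ wₗ≡0 rewrite wₗ≡0 = *-zeroʳ (z l)

disjoint-dist : ∀ {n} (z w : Vecℕ n) → DisjointSupports z w →
  dist z w ≡ ∣ z ∣ᵥ ⊔ ∣ w ∣ᵥ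
disjoint-dist {n} z w disj =
  cong₂ _⊔_ (Σ-cong n (λ l → cong (z l ∸_) (gcd-zero l)))
            (Σ-cong n (λ l → cong (w l ∸_) (gcd-zero l)))
  where
  gcd-zero : ∀ l → gcdᵥ z w l ≡ 0
  gcd-zero l with disj l
  ... | inj₁ zₗ≡0 rewrite zₗ≡0 = refl
  ... | inj₂ wₗ≡0 rewrite wₗ≡0 = ⊓-zeroʳ (z l)

-- Proposition 5.9.
proposition5p9 : (d k : ℕ) (α : Fin k → Vecℕ d) → MinimalGenerators α →
    (i : Fin k) (z : Vecℕ k) → Minimal (InZshift α i) z → z i ≡ 0 →
    (w : Vecℕ k) → w i ≢ 0 → (∀ l → φ α w l ≡ φ α z l) →
    (z · w ≡ 0) × (dist z w ≡ ∣ z ∣ᵥ ⊔ ∣ w ∣ᵥ)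
proposition5p9 d k α _ i z minimal zᵢ≡0 w wᵢ≢0 same =
  disjoint-dot z w disjoint , disjoint-dist z w disjoint
  where
  no-common : ∀ l → z l ≢ 0 → w l ≢ 0 → ⊥
  no-common l zₗ≢0 wₗ≢0 with l ≟ᶠ i
  ... | yes refl = zₗ≢0 zᵢ≡0
  ... | no  l≢i  = minimal-disjoint α minimal w wᵢ≢0 same l l≢i zₗ≢0 wₗ≢0
  disjoint : DisjointSupports z w
  disjoint = disjoint-supports z w no-common
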